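{- Each of the nine sets $UT_n, SUT_n, UF_n, SUF_n, LT_n, SLT_n, LF_n, SLF_n, D_n$ is a subsemigroup of $M_n$. The sets $UT_n$, $UF_n$, $LT_n$, $LF_n$, $D_n$ contain $\mathbf{1}$ and are submonoids of $M_n$, and removing $\mathbf{1}$ from any of these five sets yields a subsemigroup of $S_n=M_n\setminus\{\mathbf{1}\}$. Finally, $SUT_n$, $SUF_n$, $SLT_n$, $SLF_n$ consist solely of nilpotents, each nonzero element $\langle d,k,m\rangle$ of them having nilpotency index $1+\lceil (m-k+1)/|d|\rceil$.
   Context: Fix an integer $n\ge 2$. For integers $d,k,m$ with $1-\min(0,d)\le k\le m\le n-\max(0,d)$, let $\langle d,k,m\rangle$ denote the $n\times n$ matrix with entries $x_{ij}$ ($i,j\in\{1,\dots,n\}$) equal to $1$ if $k\le i\le m$ and $j-i=d$, and $0$ otherwise. Let $\mathbf{0}$ be the $n\times n$ zero matrix, $M_n=\{\mathbf{0}\}\cup\{\langle d,k,m\rangle: d\in\mathbb{Z},\ k,m\in\mathbb{N},\ 1-\min(0,d)\le k\le m\le n-\max(0,d)\}$ (a monoid under matrix multiplication with identity $\mathbf{1}=\langle 0,1,n\rangle$), and $S_n=M_n\setminus\{\mathbf{1}\}$. Each of the following sets consists of $\mathbf{0}$ together with the nonzero $\langle d,k,m\rangle\in M_n$ satisfying the stated restriction: $UT_n$: $d\ge0$; $SUT_n$: $d>0$; $UF_n$: $d\ge0$, $k=1$, $m=n-d$; $SUF_n$: $d>0$, $k=1$, $m=n-d$; $LT_n$: $d\le0$;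 $SLT_n$: $d<0$; $LF_n$: $d\le 0$, $k=1-d$, $m=n$; $SLF_n$: $d<0$, $k=1-d$, $m=n$; $D_n$: $d=0$. A submonoid of $M_n$ is a subsemigroup containing $\mathbf{1}$. The nilpotency index of a nilpotent $x$ is the least $j\in\mathbb{N}$ with $x^j=\mathbf{0}$. -}

module Defs where

open import Data.Nat as ℕ using (ℕ; zero; suc; _∸_; _≤?_)
open import Data.Nat.DivMod using (_/_)
open import Data.Integer as ℤ using (ℤ; +_; _⊓_; _⊔_)
open import Data.Fin using (Fin; toℕ; zero; suc)
open import Data.Bool using (Bool; true; false; _∧_; if_then_else_)
open import Data.Product using (Σ; _×_; _,_)
open import Data.Sum using (_⊎_)
open import Data.Unit using (⊤)
open import Relation.Nullary using (¬_)
open import Relation.Nullary.Decidable using (⌊_⌋)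
open import Relation.Binary.PropositionalEquality using (_≡_)

-- n×n matrices with natural-number entries, indexed by Fin n
-- (row/column index i : Fin n stands for the 1-based index suc (toℕ i)).
Matrix : ℕ → Set
Matrix n = Fin n → Fin n → ℕ

_≈_ : ∀ {n} → Matrix n → Matrix n → Set
A ≈ B = ∀ i j → A i j ≡ B i j

infix 4 _≈_

sumFin : ∀ n → (Fin n → ℕ) → ℕ
sumFin zero    f = 0
sumFin (suc n) f = f zero ℕ.+ sumFin n (λ i → f (suc i))

_⊗_ : ∀ {n} → Matrix n → Matrix n → Matrix n
_⊗_ {n} A B i j = sumFin n (λ l → A i l ℕ.* B l j)

infixl 7 _⊗_

𝟎 : ∀ {n} → Matrix n
𝟎 i j = 0

⟨_,_,_⟩ : ∀ {n} → ℤ → ℕ → ℕ → Matrix n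
⟨_,_,_⟩ d k m i j =
  let i' = suc (toℕ i) ; j' = suc (toℕ j) in
  if ⌊ k ≤? i' ⌋ ∧ ⌊ i' ≤? m ⌋ ∧ ⌊ (+ j') ℤ.≟ (+ i') ℤ.+ d ⌋ then 1 else 0

Valid : ℕ → ℤ → ℕ → ℕ → Set
Valid n d k m =
  (+ 1 ℤ.- (+ 0 ⊓ d)) ℤ.≤ + k × k ℕ.≤ m × + m ℤ.≤ (+ n ℤ.- (+ 0 ⊔ d))

𝟏 : ∀ {n} → Matrix n
𝟏 {n} = ⟨ + 0 , 1 , n ⟩

_^_ : ∀ {n} → Matrix n → ℕ → Matrix n
A ^ zero  = 𝟏
A ^ suc j = A ⊗ (A ^ j)

data Kind : Set where
  UT SUT UF SUF LT SLT LF SLF D : Kind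

Restr : ℕ → Kind → ℤ → ℕ → ℕ → Set
Restr n UT  d k m = + 0 ℤ.≤ d
Restr n SUT d k m = + 0 ℤ.< d
Restr n UF  d k m = + 0 ℤ.≤ d × k ≡ 1 × + m ≡ + n ℤ.- d
Restr n SUF d k m = + 0 ℤ.< d × k ≡ 1 × + m ≡ + n ℤ.- d
Restr n LT  d k m = d ℤ.≤ + 0
Restr n SLT d k m = d ℤ.< + 0
Restr n LF  d k m = d ℤ.≤ + 0 × + k ≡ + 1 ℤ.- d × m ≡ n
Restr n SLF d k m = d ℤ.< + 0 × + k ≡ + 1 ℤ.- d × m ≡ n
Restr n D   d k m = d ≡ + 0

Elem : (n : ℕ) → (ℤ → ℕ → ℕ → Set) → Matrix n → Set
Elem n R A = A ≈ 𝟎 ⊎ Σ ℤ λ d → Σ ℕ λ k → Σ ℕ λ m →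
               Valid n d k m × R d k m × A ≈ ⟨ d , k , m ⟩

InM : (n : ℕ) → Matrix n → Set
InM n = Elem n (λ _ _ _ → ⊤)

InS : (n : ℕ) → Matrix n → Set
InS n A = InM n A × ¬ (A ≈ 𝟏)

InK : (n : ℕ) → Kind → Matrix n → Set
InK n K = Elem n (Restr n K)

InKminus1 : (n : ℕ) → Kind → Matrix n → Set
InKminus1 n K A = InK n K A × ¬ (A ≈ 𝟏)

IsSubsemigroupOf : ∀ {n} → (Matrix n → Set) → (Matrix n → Set) → Set
IsSubsemigroupOf P Q =
  (∀ A → P A → Q A) × (∀ A B → P A → P B → P (A ⊗ B))

IsSubmonoidOfM : (n : ℕ) → (Matrix n → Set) → Set
IsSubmonoidOfM n P = IsSubsemigroupOf P (InM n) × P 𝟏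

IsNilpotent : ∀ {n} → Matrix n → Set
IsNilpotent A = Σ ℕ λ j → A ^ j ≈ 𝟎

NilpotencyIndex : ∀ {n} → Matrix n → ℕ → Set
NilpotencyIndex A j = A ^ j ≈ 𝟎 × (∀ i → i ℕ.< j → ¬ (A ^ i ≈ 𝟎))

-- ceiling division ⌈a / b⌉ for b ≥ 1 (value for b = 0 is irrelevant)
ceilDiv : ℕ → ℕ → ℕ
ceilDiv a zero    = 0
ceilDiv a (suc b) = (a ℕ.+ b) / suc b

-- Every ⟨d,k,m⟩ is the indicator of a segment of the d-th diagonal, and such segments
-- compose like paths: the product of the segments (d, a, b) and (d′, a′, b′) is the segment
-- (d + d′, a ⊔ (a′ − d), b ⊓ (b′ − d)), or 𝟎 when this is empty.  Closure under products is then
-- a check of each restriction against this formula.  A product of two elements of one of the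
-- sign-definite sets can only be 𝟏 if both diagonals are 0 and the first factor covers all rows,
-- i.e. is 𝟏 itself.  Iterating, ⟨d,k,m⟩^(1+j) is the segment of the diagonal (1+j)d over the rows
-- i with i and i + jd in [k, m]; it is nonempty iff k + j∣d∣ ≤ m, so the first vanishing power is
-- the (1 + ⌈(m − k + 1)/∣d∣⌉)-th.

module Submission where

open import Data.Empty using (⊥-elim)
open import Data.Fin as Fin using (Fin; zero; suc; toℕ; fromℕ; fromℕ<)
import Data.Fin.Properties as Fin
open import Data.Integer as ℤ
  using (ℤ; +_; -[1+_]; 0ℤ; ∣_∣; _+_; _-_; -_; _*_; _⊔_; _⊓_; _≤_; _<_; +≤+; -≤+)
import Data.Integer.Properties as ℤ
open import Data.Integer.Tactic.RingSolver using (solve-∀)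
open import Data.Nat as ℕ using (ℕ; zero; suc; z≤n; s≤s)
import Data.Nat.DivMod as ℕ
import Data.Nat.Properties as ℕ
open import Data.Product using (∃; _×_; _,_; proj₁; proj₂; map₁)
open import Data.Sum using (_⊎_; inj₁; inj₂)
open import Function using (_∘_; _∘₂_)
open import Function.Bundles using (_⇔_; mk⇔; Equivalence)
open import Relation.Binary.PropositionalEquality
  using (_≡_; _≢_; refl; sym; trans; cong; cong₂; subst; subst₂; module ≡-Reasoning)
open import Relation.Nullary using (¬_; Dec; yes; no; contradiction)
open import Relation.Nullary.Decidable using (_×-dec_)

open import Defs

open Equivalence using (to; from)

[i+j]-j≡i : ∀ i j → i + j - j ≡ i
[i+j]-j≡i = solve-∀

[i-j]+j≡i : ∀ i j → i - j + j ≡ i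
[i-j]+j≡i = solve-∀

[i-j]+[j+k]≡i+k : ∀ i j k → i - j + (j + k) ≡ i + k
[i-j]+[j+k]≡i+k = solve-∀

i-j-k≡i-[k+j] : ∀ i j k → i - j - k ≡ i - (k + j)
i-j-k≡i-[k+j] = solve-∀

i-j-k≡i-[j+k] : ∀ i j k → i - j - k ≡ i - (j + k)
i-j-k≡i-[j+k] = solve-∀

i-j-k≡i-k-j : ∀ i j k → i - j - k ≡ i - k - j
i-j-k≡i-k-j = solve-∀

i≡i+j⇒j≡0 : ∀ {i j} → i ≡ i + j → j ≡ 0ℤ
i≡i+j⇒j≡0 {i} {j} i≡i+j = begin
  j           ≡⟨ lemma i j ⟩
  i + j - i   ≡⟨ cong (_- i) i≡i+j ⟨
  i - i       ≡⟨ ℤ.+-inverseʳ i ⟩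
  0ℤ          ∎
  where
  open ≡-Reasoning
  lemma : ∀ i j → j ≡ i + j - i
  lemma = solve-∀

i≤j+k⇒i-k≤j : ∀ {i j k} → i ≤ j + k → i - k ≤ j
i≤j+k⇒i-k≤j {i} {j} {k} h = subst (i - k ≤_) ([i+j]-j≡i j k) (ℤ.+-monoˡ-≤ (- k) h)

i-k≤j⇒i≤j+k : ∀ {i j k} → i - k ≤ j → i ≤ j + k
i-k≤j⇒i≤j+k {i} {j} {k} h = subst (_≤ j + k) ([i-j]+j≡i i k) (ℤ.+-monoˡ-≤ k h)

i+k≤j⇒i≤j-k : ∀ {i j k} → i + k ≤ j → i ≤ j - k
i+k≤j⇒i≤j-k {i} {j} {k} h = subst (_≤ j - k) ([i+j]-j≡i i k) (ℤ.+-monoˡ-≤ (- k) h)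

i≤j-k⇒i+k≤j : ∀ {i j k} → i ≤ j - k → i + k ≤ j
i≤j-k⇒i+k≤j {i} {j} {k} h = subst (i + k ≤_) ([i-j]+j≡i j k) (ℤ.+-monoˡ-≤ k h)

0≤j⇒i-j≤i : ∀ {i j} → 0ℤ ≤ j → i - j ≤ i
0≤j⇒i-j≤i {i} {j} 0≤j = ℤ.i-j≤i i j {{ℤ.nonNegative 0≤j}}

j≤0⇒i≤i-j : ∀ {i j} → j ≤ 0ℤ → i ≤ i - j
j≤0⇒i≤i-j {i} {j} j≤0 = ℤ.i≤i+j i (- j) {{ℤ.nonNegative (ℤ.neg-mono-≤ j≤0)}}

+-distribˡ-⊓ : ∀ i j k → i + (j ⊓ k) ≡ (i + j) ⊓ (i + k)
+-distribˡ-⊓ i = ℤ.mono-≤-distrib-⊓ (ℤ.+-monoʳ-≤ i)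

+-distribˡ-⊔ : ∀ i j k → i + (j ⊔ k) ≡ (i + j) ⊔ (i + k)
+-distribˡ-⊔ i = ℤ.mono-≤-distrib-⊔ (ℤ.+-monoʳ-≤ i)

≤⊓⇔ : ∀ {i j k} → i ≤ j ⊓ k ⇔ (i ≤ j × i ≤ k)
≤⊓⇔ {j = j} {k} = mk⇔
  (λ h → ℤ.≤-trans h (ℤ.i⊓j≤i j k) , ℤ.≤-trans h (ℤ.i⊓j≤j j k))
  (λ (i≤j , i≤k) → ℤ.⊓-glb i≤j i≤k)

⊔≤⇔ : ∀ {i j k} → j ⊔ k ≤ i ⇔ (j ≤ i × k ≤ i)
⊔≤⇔ {j = j} {k} = mk⇔
  (λ h → ℤ.≤-trans (ℤ.i≤i⊔j j k) h , ℤ.≤-trans (ℤ.i≤j⊔i j k) h)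
  (λ (j≤i , k≤i) → ℤ.⊔-lub j≤i k≤i)

SameSign : ℤ → ℤ → Set
SameSign i j = (0ℤ ≤ i × 0ℤ ≤ j) ⊎ (i ≤ 0ℤ × j ≤ 0ℤ)

sameSign-* : ∀ j d → SameSign d (+ j * d)
sameSign-* j d with ℤ.≤-total 0ℤ d
... | inj₁ 0≤d = inj₁ (0≤d , subst (_≤ + j * d) (ℤ.*-zeroʳ (+ j)) (ℤ.*-monoˡ-≤-nonNeg (+ j) 0≤d))
... | inj₂ d≤0 = inj₂ (d≤0 , subst (+ j * d ≤_) (ℤ.*-zeroʳ (+ j)) (ℤ.*-monoˡ-≤-nonNeg (+ j) d≤0))

-- The rows i with both i and i + t in [a, b] are those with lower a t ≤ i ≤ upper b t.

lower : ℤ → ℤ → ℤ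
lower a t = a ⊔ (a - t)

upper : ℤ → ℤ → ℤ
upper b t = b ⊓ (b - t)

lower-nonNeg : ∀ a {t} → 0ℤ ≤ t → lower a t ≡ a
lower-nonNeg _ 0≤t = ℤ.i≥j⇒i⊔j≡i (0≤j⇒i-j≤i 0≤t)

lower-nonPos : ∀ a {t} → t ≤ 0ℤ → lower a t ≡ a - t
lower-nonPos _ t≤0 = ℤ.i≤j⇒i⊔j≡j (j≤0⇒i≤i-j t≤0)

upper-nonNeg : ∀ b {t} → 0ℤ ≤ t → upper b t ≡ b - t
upper-nonNeg _ 0≤t = ℤ.i≥j⇒i⊓j≡j (0≤j⇒i-j≤i 0≤t)

upper-nonPos : ∀ b {t} → t ≤ 0ℤ → upper b t ≡ b
upper-nonPos _ t≤0 = ℤ.i≤j⇒i⊓j≡i (j≤0⇒i≤i-j t≤0)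

lower-step : ∀ a {d t} → SameSign d t → a ⊔ (lower a t - d) ≡ lower a (d + t)
lower-step a {d} {t} (inj₁ (0≤d , 0≤t)) = begin
  a ⊔ (lower a t - d)   ≡⟨ cong (λ x → a ⊔ (x - d)) (lower-nonNeg a 0≤t) ⟩
  lower a d             ≡⟨ lower-nonNeg a 0≤d ⟩
  a                     ≡⟨ lower-nonNeg a (ℤ.+-mono-≤ 0≤d 0≤t) ⟨
  lower a (d + t)       ∎
  where open ≡-Reasoning
lower-step a {d} {t} (inj₂ (_ , t≤0)) =
  trans (cong (λ x → a ⊔ (x - d)) (lower-nonPos a t≤0)) (cong (a ⊔_) (i-j-k≡i-[k+j] a t d))

upper-step : ∀ b {d t} → SameSign d t → b ⊓ (upper b t - d) ≡ upper b (d + t)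
upper-step b {d} {t} (inj₁ (_ , 0≤t)) =
  trans (cong (λ x → b ⊓ (x - d)) (upper-nonNeg b 0≤t)) (cong (b ⊓_) (i-j-k≡i-[k+j] b t d))
upper-step b {d} {t} (inj₂ (d≤0 , t≤0)) = begin
  b ⊓ (upper b t - d)   ≡⟨ cong (λ x → b ⊓ (x - d)) (upper-nonPos b t≤0) ⟩
  upper b d             ≡⟨ upper-nonPos b d≤0 ⟩
  b                     ≡⟨ upper-nonPos b (ℤ.+-mono-≤ d≤0 t≤0) ⟨
  upper b (d + t)       ∎
  where open ≡-Reasoning

lower≤upper⇔ : ∀ k m t → lower (+ k) t ≤ upper (+ m) t ⇔ k ℕ.+ ∣ t ∣ ℕ.≤ m
lower≤upper⇔ k m (+ u)
  rewrite lower-nonNeg (+ k) {+ u} (+≤+ z≤n) | upper-nonNeg (+ m) {+ u} (+≤+ z≤n) =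
  mk⇔ (ℤ.drop‿+≤+ ∘ i≤j-k⇒i+k≤j {k = + u}) (i+k≤j⇒i≤j-k {k = + u} ∘ +≤+)
lower≤upper⇔ k m -[1+ u ]
  rewrite lower-nonPos (+ k) { -[1+ u ]} -≤+ | upper-nonPos (+ m) { -[1+ u ]} -≤+ =
  mk⇔ ℤ.drop‿+≤+ +≤+

sumFin-zero : ∀ n {f : Fin n → ℕ} → (∀ l → f l ≡ 0) → sumFin n f ≡ 0
sumFin-zero zero    f≡0 = refl
sumFin-zero (suc n) f≡0 = cong₂ ℕ._+_ (f≡0 zero) (sumFin-zero n (f≡0 ∘ suc))

sumFin-single : ∀ n {f : Fin n → ℕ} l₀ → (∀ l → l ≢ l₀ → f l ≡ 0) → sumFin n f ≡ f l₀
sumFin-single (suc n) {f} zero f≡0 =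
  trans (cong (f zero ℕ.+_) (sumFin-zero n λ l → f≡0 (suc l) λ ())) (ℕ.+-identityʳ (f zero))
sumFin-single (suc n) {f} (suc l₀) f≡0 =
  trans (cong (ℕ._+ sumFin n (f ∘ suc)) (f≡0 zero λ ()))
        (sumFin-single n l₀ λ l l≢l₀ → f≡0 (suc l) (l≢l₀ ∘ Fin.suc-injective))

sumFin-cong : ∀ n {f g : Fin n → ℕ} → (∀ l → f l ≡ g l) → sumFin n f ≡ sumFin n g
sumFin-cong zero    f≡g = refl
sumFin-cong (suc n) f≡g = cong₂ ℕ._+_ (f≡g zero) (sumFin-cong n (f≡g ∘ suc))

⊗-zeroˡ : ∀ {n} {A : Matrix n} B → A ≈ 𝟎 → A ⊗ B ≈ 𝟎
⊗-zeroˡ {n} B A≈𝟎 i j = sumFin-zero n λ l → cong (ℕ._* B l j) (A≈𝟎 i l)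

⊗-zeroʳ : ∀ {n} A {B : Matrix n} → B ≈ 𝟎 → A ⊗ B ≈ 𝟎
⊗-zeroʳ {n} A B≈𝟎 i j =
  sumFin-zero n λ l → trans (cong (A i l ℕ.*_) (B≈𝟎 l j)) (ℕ.*-zeroʳ (A i l))

⊗-cong : ∀ {n} {A A′ B B′ : Matrix n} → A ≈ A′ → B ≈ B′ → A ⊗ B ≈ A′ ⊗ B′
⊗-cong {n} A≈A′ B≈B′ i j = sumFin-cong n λ l → cong₂ ℕ._*_ (A≈A′ i l) (B≈B′ l j)

^-cong : ∀ {n} {A B : Matrix n} → A ≈ B → ∀ j → A ^ j ≈ B ^ j
^-cong A≈B zero    = λ _ _ → refl
^-cong A≈B (suc j) = ⊗-cong A≈B (^-cong A≈B j)

index : ∀ {n} → Fin n → ℤ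
index i = + suc (toℕ i)

index-injective : ∀ {n} {i j : Fin n} → index i ≡ index j → i ≡ j
index-injective = Fin.toℕ-injective ∘ ℕ.suc-injective ∘ ℤ.+-injective

index-surjective : ∀ {n x} → + 1 ≤ x → x ≤ + n → ∃ λ (i : Fin n) → index i ≡ x
index-surjective {x = + zero}  (+≤+ ()) _
index-surjective {x = + suc x} _ (+≤+ x<n) = fromℕ< x<n , cong (+_ ∘ suc) (Fin.toℕ-fromℕ< x<n)

OnBand : ℤ → ℤ → ℤ → ℤ → ℤ → Set
OnBand e a b x y = a ≤ x × x ≤ b × y ≡ x + e

onBand? : ∀ e a b x y → Dec (OnBand e a b x y)
onBand? e a b x y = a ℤ.≤? x ×-dec x ℤ.≤? b ×-dec y ℤ.≟ x + e

-- The 0/1 matrix whose ones are the positions (i, i + e) with a ≤ i ≤ b; the bounds are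
-- arbitrary integers, so the segment of the diagonal may stick out of the grid.
record Band {n} (A : Matrix n) (e a b : ℤ) : Set where
  field
    on  : ∀ i j → OnBand e a b (index i) (index j) → A i j ≡ 1
    off : ∀ i j → ¬ OnBand e a b (index i) (index j) → A i j ≡ 0

open Band

⟨⟩-band : ∀ {n} d k m → Band {n} ⟨ d , k , m ⟩ d (+ k) (+ m)
⟨⟩-band {n} d k m = record { on = λ i j → proj₁ (entry i j) ; off = λ i j → proj₂ (entry i j) }
  where
  entry : ∀ i j → (OnBand d (+ k) (+ m) (index i) (index j) → ⟨ d , k , m ⟩ i j ≡ 1)
                × (¬ OnBand d (+ k) (+ m) (index i) (index j) → ⟨ d , k , m ⟩ i j ≡ 0)
  entry i j with k ℕ.≤? suc (toℕ i) | suc (toℕ i) ℕ.≤? m | (+ suc (toℕ j)) ℤ.≟ (+ suc (toℕ i)) + d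
  ... | yes k≤i | yes i≤m | yes j≡i+d =
        (λ _ → refl) , λ ¬on → ⊥-elim (¬on (+≤+ k≤i , +≤+ i≤m , j≡i+d))
  ... | no k≰i  | _       | _         = (λ on → ⊥-elim (k≰i (ℤ.drop‿+≤+ (proj₁ on)))) , λ _ → refl
  ... | yes _   | no i≰m  | _         =
        (λ on → ⊥-elim (i≰m (ℤ.drop‿+≤+ (proj₁ (proj₂ on))))) , λ _ → refl
  ... | yes _   | yes _   | no j≢i+d  = (λ on → ⊥-elim (j≢i+d (proj₂ (proj₂ on)))) , λ _ → refl

band-cong : ∀ {n} {A : Matrix n} {e a b e′ a′ b′} →
  e ≡ e′ → a ≡ a′ → b ≡ b′ → Band A e a b → Band A e′ a′ b′
band-cong refl refl refl P = P

band-resp-≈ : ∀ {n} {A B : Matrix n} {e a b} → A ≈ B → Band A e a b → Band B e a b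
band-resp-≈ A≈B P = record
  { on  = λ i j c → trans (sym (A≈B i j)) (on P i j c)
  ; off = λ i j c → trans (sym (A≈B i j)) (off P i j c)
  }

band-unique : ∀ {n} {A B : Matrix n} {e a b} → Band A e a b → Band B e a b → A ≈ B
band-unique {e = e} {a} {b} P Q i j with onBand? e a b (index i) (index j)
... | yes c = trans (on P i j c) (sym (on Q i j c))
... | no ¬c = trans (off P i j ¬c) (sym (off Q i j ¬c))

band-on⁻¹ : ∀ {n} {A : Matrix n} {e a b} → Band A e a b →
  ∀ {i j} → A i j ≡ 1 → OnBand e a b (index i) (index j)
band-on⁻¹ {e = e} {a} {b} P {i} {j} Aij≡1 with onBand? e a b (index i) (index j)
... | yes c = c
... | no ¬c = contradiction (trans (sym Aij≡1) (off P i j ¬c)) λ ()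

band-empty : ∀ {n} {A : Matrix n} {e a b} → b < a → Band A e a b → A ≈ 𝟎
band-empty b<a P i j = off P i j λ (a≤x , x≤b , _) → ℤ.<⇒≱ b<a (ℤ.≤-trans a≤x x≤b)

onBand-∘ : ∀ {e a b e′ a′ b′ x y z} → OnBand e a b x y → OnBand e′ a′ b′ y z →
  OnBand (e + e′) (a ⊔ (a′ - e)) (b ⊓ (b′ - e)) x z
onBand-∘ {e} {e′ = e′} {a′ = a′} {b′} {x} (a≤x , x≤b , y≡x+e) (a′≤y , y≤b′ , z≡y+e′) =
  ℤ.⊔-lub a≤x (i≤j+k⇒i-k≤j (subst (a′ ≤_) y≡x+e a′≤y)) ,
  ℤ.⊓-glb x≤b (i+k≤j⇒i≤j-k (subst (_≤ b′) y≡x+e y≤b′)) ,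
  trans z≡y+e′ (trans (cong (_+ e′) y≡x+e) (ℤ.+-assoc x e e′))

onBand-∘⁻¹ : ∀ {e a b e′ a′ b′ x z} → OnBand (e + e′) (a ⊔ (a′ - e)) (b ⊓ (b′ - e)) x z →
  OnBand e a b x (x + e) × OnBand e′ a′ b′ (x + e) z
onBand-∘⁻¹ {e} {a} {b} {e′} {a′} {b′} {x} (a⊔≤x , x≤b⊓ , z≡x+[e+e′]) =
  (proj₁ (to ⊔≤⇔ a⊔≤x) , proj₁ (to ≤⊓⇔ x≤b⊓) , refl) ,
  (i-k≤j⇒i≤j+k (proj₂ (to ⊔≤⇔ a⊔≤x)) , i≤j-k⇒i+k≤j (proj₂ (to ≤⊓⇔ x≤b⊓)) ,
   trans z≡x+[e+e′] (sym (ℤ.+-assoc x e e′)))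

-- The middle index x + e of a product entry (x, z) is a valid index because a′ ≥ 1 and b′ ≤ n.
band-⊗ : ∀ {n} {A B : Matrix n} {e a b e′ a′ b′} → + 1 ≤ a′ → b′ ≤ + n →
  Band A e a b → Band B e′ a′ b′ → Band (A ⊗ B) (e + e′) (a ⊔ (a′ - e)) (b ⊓ (b′ - e))
band-⊗ {n} {A} {B} {e} {a} {b} {e′} {a′} {b′} 1≤a′ b′≤n P Q =
  record { on = onProduct ; off = offProduct }
  where
  OnProduct : Fin n → Fin n → Set
  OnProduct i j = OnBand (e + e′) (a ⊔ (a′ - e)) (b ⊓ (b′ - e)) (index i) (index j)
  onProduct : ∀ i j → OnProduct i j → (A ⊗ B) i j ≡ 1
  onProduct i j c = trans (sumFin-single n l others) (cong₂ ℕ._*_ (on P i l onA) (on Q l j onB))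
    where
    cA = proj₁ (onBand-∘⁻¹ {e} {a} {b} {e′} {a′} {b′} c)
    cB = proj₂ (onBand-∘⁻¹ {e} {a} {b} {e′} {a′} {b′} c)
    middle = index-surjective (ℤ.≤-trans 1≤a′ (proj₁ cB)) (ℤ.≤-trans (proj₁ (proj₂ cB)) b′≤n)
    l = proj₁ middle
    l≡i+e = proj₂ middle
    onA : OnBand e a b (index i) (index l)
    onA = subst (OnBand e a b (index i)) (sym l≡i+e) cA
    onB : OnBand e′ a′ b′ (index l) (index j)
    onB = subst (λ y → OnBand e′ a′ b′ y (index j)) (sym l≡i+e) cB
    others : ∀ l′ → l′ ≢ l → A i l′ ℕ.* B l′ j ≡ 0
    others l′ l′≢l = cong (ℕ._* B l′ j) (off P i l′ λ (_ , _ , l′≡i+e) →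
      l′≢l (index-injective (trans l′≡i+e (sym l≡i+e))))
  offProduct : ∀ i j → ¬ OnProduct i j → (A ⊗ B) i j ≡ 0
  offProduct i j ¬c = sumFin-zero n term
    where
    term : ∀ l → A i l ℕ.* B l j ≡ 0
    term l with onBand? e a b (index i) (index l) | onBand? e′ a′ b′ (index l) (index j)
    ... | no ¬cA | _      = cong (ℕ._* B l j) (off P i l ¬cA)
    ... | yes _  | no ¬cB = trans (cong (A i l ℕ.*_) (off Q l j ¬cB)) (ℕ.*-zeroʳ (A i l))
    ... | yes cA | yes cB = ⊥-elim (¬c (onBand-∘ cA cB))

𝟏-diagonal : ∀ {n} (i : Fin n) → 𝟏 i i ≡ 1
𝟏-diagonal i =
  on (⟨⟩-band 0ℤ 1 _) i i (+≤+ (s≤s z≤n) , +≤+ (Fin.toℕ<n i) , sym (ℤ.+-identityʳ (index i)))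

𝟏-offDiagonal : ∀ {n} {i j : Fin n} → i ≢ j → 𝟏 i j ≡ 0
𝟏-offDiagonal i≢j = off (⟨⟩-band 0ℤ 1 _) _ _ λ (_ , _ , j≡i+0) →
  i≢j (index-injective (sym (trans j≡i+0 (ℤ.+-identityʳ _))))

⊗-identityʳ : ∀ {n} (A : Matrix n) → A ⊗ 𝟏 ≈ A
⊗-identityʳ {n} A i j = begin
  sumFin n (λ l → A i l ℕ.* 𝟏 l j) ≡⟨ sumFin-single n j offDiagonal ⟩
  A i j ℕ.* 𝟏 j j                   ≡⟨ cong (A i j ℕ.*_) (𝟏-diagonal j) ⟩
  A i j ℕ.* 1                       ≡⟨ ℕ.*-identityʳ (A i j) ⟩
  A i j                             ∎
  where
  open ≡-Reasoning
  offDiagonal : ∀ l → l ≢ j → A i l ℕ.* 𝟏 l j ≡ 0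
  offDiagonal l l≢j = trans (cong (A i l ℕ.*_) (𝟏-offDiagonal l≢j)) (ℕ.*-zeroʳ (A i l))

𝟏≉𝟎 : ∀ {n} → 1 ℕ.≤ n → ¬ (𝟏 {n} ≈ 𝟎)
𝟏≉𝟎 {suc n} _ 𝟏≈𝟎 = contradiction (trans (sym (𝟏-diagonal {suc n} zero)) (𝟏≈𝟎 zero zero)) λ ()

record Fits (n : ℕ) (e a b : ℤ) : Set where
  constructor mkFits
  field
    firstRow≥1    : + 1 ≤ a
    firstColumn≥1 : + 1 ≤ a + e
    lastRow≤n     : b ≤ + n
    lastColumn≤n  : b + e ≤ + n

open Fits

fits-⊗ : ∀ {n e a b e′ a′ b′} → + 1 ≤ a → b ≤ + n → Fits n e′ a′ b′ →
  Fits n (e + e′) (a ⊔ (a′ - e)) (b ⊓ (b′ - e))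
fits-⊗ {n} {e} {a} {b} {e′} {a′} {b′} 1≤a b≤n F = mkFits
  (ℤ.≤-trans 1≤a (ℤ.i≤i⊔j a _))
  (ℤ.≤-trans (firstColumn≥1 F) (subst (_≤ (a ⊔ (a′ - e)) + (e + e′)) ([i-j]+[j+k]≡i+k a′ e e′)
                                       (ℤ.+-monoˡ-≤ (e + e′) (ℤ.i≤j⊔i a _))))
  (ℤ.≤-trans (ℤ.i⊓j≤i b _) b≤n)
  (ℤ.≤-trans (subst ((b ⊓ (b′ - e)) + (e + e′) ≤_) ([i-j]+[j+k]≡i+k b′ e e′)
                    (ℤ.+-monoˡ-≤ (e + e′) (ℤ.i⊓j≤j b _)))
             (lastColumn≤n F))

band-nonzero : ∀ {n} {A : Matrix n} {e a b} → Band A e a b → Fits n e a b → a ≤ b → ¬ (A ≈ 𝟎)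
band-nonzero {e = e} {a} P (mkFits 1≤a 1≤a+e b≤n b+e≤n) a≤b A≈𝟎
  with index-surjective 1≤a (ℤ.≤-trans a≤b b≤n)
     | index-surjective 1≤a+e (ℤ.≤-trans (ℤ.+-monoˡ-≤ e a≤b) b+e≤n)
... | i , i≡a | j , j≡a+e =
  contradiction (trans (sym (on P i j onDiagonal)) (A≈𝟎 i j)) λ ()
  where
  onDiagonal =
    ℤ.≤-reflexive (sym i≡a) , subst (_≤ _) (sym i≡a) a≤b , trans j≡a+e (cong (_+ e) (sym i≡a))

lowerValid⇔ : ∀ {d x} → + 1 - (0ℤ ⊓ d) ≤ x ⇔ (+ 1 ≤ x × + 1 ≤ x + d)
lowerValid⇔ {d} {x} = mk⇔
  (λ h → map₁ (subst (+ 1 ≤_) (ℤ.+-identityʳ x)) (to ≤⊓⇔ (subst (+ 1 ≤_) eq (i-k≤j⇒i≤j+k h))))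
  (λ (1≤x , 1≤x+d) → i≤j+k⇒i-k≤j (subst (+ 1 ≤_) (sym eq)
     (from ≤⊓⇔ (subst (+ 1 ≤_) (sym (ℤ.+-identityʳ x)) 1≤x , 1≤x+d))))
  where
  eq : x + (0ℤ ⊓ d) ≡ (x + 0ℤ) ⊓ (x + d)
  eq = +-distribˡ-⊓ x 0ℤ d

upperValid⇔ : ∀ {n d y} → y ≤ + n - (0ℤ ⊔ d) ⇔ (y ≤ + n × y + d ≤ + n)
upperValid⇔ {n} {d} {y} = mk⇔
  (λ h → map₁ (subst (_≤ + n) (ℤ.+-identityʳ y)) (to ⊔≤⇔ (subst (_≤ + n) eq (i≤j-k⇒i+k≤j h))))
  (λ (y≤n , y+d≤n) → i+k≤j⇒i≤j-k (subst (_≤ + n) (sym eq)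
     (from ⊔≤⇔ (subst (_≤ + n) (sym (ℤ.+-identityʳ y)) y≤n , y+d≤n))))
  where
  eq : y + (0ℤ ⊔ d) ≡ (y + 0ℤ) ⊔ (y + d)
  eq = +-distribˡ-⊔ y 0ℤ d

valid⇒fits : ∀ {n} d {k m} → Valid n d k m → Fits n d (+ k) (+ m)
valid⇒fits {n} d (lo , _ , hi) with to (lowerValid⇔ {d}) lo | to (upperValid⇔ {n} {d}) hi
... | 1≤k , 1≤k+d | m≤n , m+d≤n = mkFits 1≤k 1≤k+d m≤n m+d≤n

fits⇒valid : ∀ {n d k m} → Fits n d (+ k) (+ m) → k ℕ.≤ m → Valid n d k m
fits⇒valid {n} {d} (mkFits 1≤k 1≤k+d m≤n m+d≤n) k≤m =
  from (lowerValid⇔ {d}) (1≤k , 1≤k+d) , k≤m , from (upperValid⇔ {n} {d}) (m≤n , m+d≤n)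

⟨⟩⊗⟨⟩-band : ∀ {n} d k m {d′ k′ m′} → Fits n d′ (+ k′) (+ m′) →
  Band (⟨_,_,_⟩ {n} d k m ⊗ ⟨ d′ , k′ , m′ ⟩) (d + d′) (+ k ⊔ (+ k′ - d)) (+ m ⊓ (+ m′ - d))
⟨⟩⊗⟨⟩-band d k m {d′} {k′} {m′} F′ =
  band-⊗ (firstRow≥1 F′) (lastRow≤n F′) (⟨⟩-band d k m) (⟨⟩-band d′ k′ m′)

-- Closure under products

band⇒elem : ∀ {n R} {C : Matrix n} {e a b} → Band C e a b → Fits n e a b →
  (∀ {k m} → + k ≡ a → + m ≡ b → R e k m) → Elem n R C
band⇒elem {n} {C = C} {e} {a} {b} P F R-ab with a ℤ.≤? b
... | no a≰b = inj₁ (band-empty (ℤ.≰⇒> a≰b) P)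
... | yes a≤b =
  inj₂ (e , ∣ a ∣ , ∣ b ∣ , valid , R-ab a≡ b≡ , band-unique P′ (⟨⟩-band e ∣ a ∣ ∣ b ∣))
  where
  a≡ : + ∣ a ∣ ≡ a
  a≡ = ℤ.0≤i⇒+∣i∣≡i (ℤ.≤-trans (+≤+ z≤n) (firstRow≥1 F))
  b≡ : + ∣ b ∣ ≡ b
  b≡ = ℤ.0≤i⇒+∣i∣≡i (ℤ.≤-trans (ℤ.≤-trans (+≤+ z≤n) (firstRow≥1 F)) a≤b)
  valid : Valid n e ∣ a ∣ ∣ b ∣
  valid = fits⇒valid (subst₂ (Fits n e) (sym a≡) (sym b≡) F)
                     (ℤ.drop‿+≤+ (subst₂ _≤_ (sym a≡) (sym b≡) a≤b))
  P′ : Band C e (+ ∣ a ∣) (+ ∣ b ∣)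
  P′ = band-cong refl (sym a≡) (sym b≡) P

-- A nonzero product ⟨ d , k , m ⟩ ⊗ ⟨ d′ , k′ , m′ ⟩ is ⟨ d + d′ , k″ , m″ ⟩ with k″, m″ as below.
ProductClosed : (ℤ → ℕ → ℕ → Set) → Set
ProductClosed R = ∀ {d k m d′ k′ m′ k″ m″} → R d k m → R d′ k′ m′ →
  + k″ ≡ + k ⊔ (+ k′ - d) → + m″ ≡ + m ⊓ (+ m′ - d) → R (d + d′) k″ m″

elem⇒inM : ∀ {n R} {A : Matrix n} → Elem n R A → InM n A
elem⇒inM (inj₁ A≈𝟎)                     = inj₁ A≈𝟎
elem⇒inM (inj₂ (d , k , m , v , _ , A≈)) = inj₂ (d , k , m , v , _ , A≈)

elem-⊗ : ∀ {n R} {A B : Matrix n} → ProductClosed R → Elem n R A → Elem n R B → Elem n R (A ⊗ B)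
elem-⊗ {B = B} _ (inj₁ A≈𝟎) _          = inj₁ (⊗-zeroˡ B A≈𝟎)
elem-⊗ {A = A} _ (inj₂ _)   (inj₁ B≈𝟎) = inj₁ (⊗-zeroʳ A B≈𝟎)
elem-⊗ closed (inj₂ (d , k , m , v , r , A≈)) (inj₂ (d′ , k′ , m′ , v′ , r′ , B≈)) =
  band⇒elem (band-resp-≈ (⊗-cong (sym ∘₂ A≈) (sym ∘₂ B≈)) (⟨⟩⊗⟨⟩-band d k m F′))
            (fits-⊗ {e = d} (firstRow≥1 F) (lastRow≤n F) F′)
            (closed r r′)
  where
  F  = valid⇒fits d v
  F′ = valid⇒fits d′ v′

isSubsemigroup : ∀ {n R} → ProductClosed R → IsSubsemigroupOf (Elem n R) (InM n)
isSubsemigroup closed = (λ _ → elem⇒inM) , λ _ _ → elem-⊗ closed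

fullUpper-closed : ∀ {n d d′ m m′ k″ m″} → 0ℤ ≤ d → 0ℤ ≤ d′ → + m ≡ + n - d → + m′ ≡ + n - d′ →
  + k″ ≡ + 1 ⊔ (+ 1 - d) → + m″ ≡ + m ⊓ (+ m′ - d) → k″ ≡ 1 × + m″ ≡ + n - (d + d′)
fullUpper-closed {n} {d} {d′} {m} {m′} {m″ = m″} 0≤d 0≤d′ m≡ m′≡ k″≡ m″≡ =
  ℤ.+-injective (trans k″≡ (lower-nonNeg (+ 1) 0≤d)) , (begin
    + m″                         ≡⟨ m″≡ ⟩
    + m ⊓ (+ m′ - d)             ≡⟨ cong₂ (λ x y → x ⊓ (y - d)) m≡ m′≡ ⟩
    (+ n - d) ⊓ (+ n - d′ - d)   ≡⟨ cong ((+ n - d) ⊓_) (i-j-k≡i-k-j (+ n) d′ d) ⟩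
    upper (+ n - d) d′           ≡⟨ upper-nonNeg (+ n - d) 0≤d′ ⟩
    + n - d - d′                 ≡⟨ i-j-k≡i-[j+k] (+ n) d d′ ⟩
    + n - (d + d′)               ∎)
  where open ≡-Reasoning

fullLower-closed : ∀ {n d d′ k k′ k″ m″} → d ≤ 0ℤ → d′ ≤ 0ℤ → + k ≡ + 1 - d → + k′ ≡ + 1 - d′ →
  + k″ ≡ + k ⊔ (+ k′ - d) → + m″ ≡ + n ⊓ (+ n - d) → + k″ ≡ + 1 - (d + d′) × m″ ≡ n
fullLower-closed {n} {d} {d′} {k} {k′} {k″} d≤0 d′≤0 k≡ k′≡ k″≡ m″≡ = (begin
    + k″                         ≡⟨ k″≡ ⟩
    + k ⊔ (+ k′ - d)             ≡⟨ cong₂ (λ x y → x ⊔ (y - d)) k≡ k′≡ ⟩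
    (+ 1 - d) ⊔ (+ 1 - d′ - d)   ≡⟨ cong ((+ 1 - d) ⊔_) (i-j-k≡i-k-j (+ 1) d′ d) ⟩
    lower (+ 1 - d) d′           ≡⟨ lower-nonPos (+ 1 - d) d′≤0 ⟩
    + 1 - d - d′                 ≡⟨ i-j-k≡i-[j+k] (+ 1) d d′ ⟩
    + 1 - (d + d′)               ∎) ,
  ℤ.+-injective (trans m″≡ (upper-nonPos (+ n) d≤0))
  where open ≡-Reasoning

restr-productClosed : ∀ {n} K → ProductClosed (Restr n K)
restr-productClosed UT  r r′ _ _ = ℤ.+-mono-≤ r r′
restr-productClosed SUT r r′ _ _ = ℤ.+-mono-< r r′
restr-productClosed LT  r r′ _ _ = ℤ.+-mono-≤ r r′
restr-productClosed SLT r r′ _ _ = ℤ.+-mono-< r r′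
restr-productClosed D   r r′ _ _ = cong₂ _+_ r r′
restr-productClosed UF (r , refl , m≡) (r′ , refl , m′≡) k″≡ m″≡ =
  ℤ.+-mono-≤ r r′ , fullUpper-closed r r′ m≡ m′≡ k″≡ m″≡
restr-productClosed SUF (r , refl , m≡) (r′ , refl , m′≡) k″≡ m″≡ =
  ℤ.+-mono-< r r′ , fullUpper-closed (ℤ.<⇒≤ r) (ℤ.<⇒≤ r′) m≡ m′≡ k″≡ m″≡
restr-productClosed LF (r , k≡ , refl) (r′ , k′≡ , refl) k″≡ m″≡ =
  ℤ.+-mono-≤ r r′ , fullLower-closed r r′ k≡ k′≡ k″≡ m″≡
restr-productClosed SLF (r , k≡ , refl) (r′ , k′≡ , refl) k″≡ m″≡ =
  ℤ.+-mono-< r r′ , fullLower-closed (ℤ.<⇒≤ r) (ℤ.<⇒≤ r′) k≡ k′≡ k″≡ m″≡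

-- The identity

NonCancelling : (ℤ → ℕ → ℕ → Set) → Set
NonCancelling R = ∀ {d k m d′ k′ m′} → R d k m → R d′ k′ m′ → d + d′ ≡ 0ℤ → d ≡ 0ℤ

band≈𝟏 : ∀ {n} {C : Matrix (suc n)} {e a b} → Band C e a b → C ≈ 𝟏 →
  e ≡ 0ℤ × a ≤ + 1 × + suc n ≤ b
band≈𝟏 {n} P C≈𝟏 =
  i≡i+j⇒j≡0 (proj₂ (proj₂ first)) ,
  proj₁ first ,
  subst (λ x → + suc x ≤ _) (Fin.toℕ-fromℕ n) (proj₁ (proj₂ last))
  where
  first = band-on⁻¹ P (trans (C≈𝟏 zero zero) (𝟏-diagonal {suc n} zero))
  last  = band-on⁻¹ P (trans (C≈𝟏 (fromℕ n) (fromℕ n)) (𝟏-diagonal (fromℕ n)))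

⟨⟩≈𝟏 : ∀ {n d k m} → Fits n d (+ k) (+ m) → d ≡ 0ℤ → k ℕ.≤ 1 → n ℕ.≤ m → ⟨_,_,_⟩ {n} d k m ≈ 𝟏
⟨⟩≈𝟏 F refl k≤1 n≤m
  with ℕ.≤-antisym k≤1 (ℤ.drop‿+≤+ (firstRow≥1 F)) | ℕ.≤-antisym (ℤ.drop‿+≤+ (lastRow≤n F)) n≤m
... | refl | refl = λ _ _ → refl

⊗≈𝟏⇒≈𝟏 : ∀ {n R} {A B : Matrix n} → NonCancelling R → Elem n R A → Elem n R B → A ⊗ B ≈ 𝟏 → A ≈ 𝟏
⊗≈𝟏⇒≈𝟏 {zero} _ _ _ _ ()
⊗≈𝟏⇒≈𝟏 {suc n} {B = B} _ (inj₁ A≈𝟎) _ AB≈𝟏 =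
  ⊥-elim (𝟏≉𝟎 (s≤s z≤n) λ i j → trans (sym (AB≈𝟏 i j)) (⊗-zeroˡ B A≈𝟎 i j))
⊗≈𝟏⇒≈𝟏 {suc n} {A = A} _ (inj₂ _) (inj₁ B≈𝟎) AB≈𝟏 =
  ⊥-elim (𝟏≉𝟎 (s≤s z≤n) λ i j → trans (sym (AB≈𝟏 i j)) (⊗-zeroʳ A B≈𝟎 i j))
⊗≈𝟏⇒≈𝟏 {suc n} nc (inj₂ (d , k , m , v , r , A≈)) (inj₂ (d′ , k′ , m′ , v′ , r′ , B≈)) AB≈𝟏
  with band≈𝟏 (band-resp-≈ (⊗-cong (sym ∘₂ A≈) (sym ∘₂ B≈)) (⟨⟩⊗⟨⟩-band d k m (valid⇒fits d′ v′)))
               AB≈𝟏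
... | d+d′≡0 , a≤1 , 1+n≤b = λ i j → trans (A≈ i j) (⟨⟩≈𝟏 (valid⇒fits d v) (nc r r′ d+d′≡0)
  (ℤ.drop‿+≤+ (ℤ.≤-trans (ℤ.i≤i⊔j (+ k) _) a≤1))
  (ℤ.drop‿+≤+ (ℤ.≤-trans 1+n≤b (ℤ.i⊓j≤i (+ m) _))) i j)

isSubsemigroup-∖𝟏 : ∀ {n R} → ProductClosed R → NonCancelling R →
  IsSubsemigroupOf (λ A → Elem n R A × ¬ (A ≈ 𝟏)) (InS n)
isSubsemigroup-∖𝟏 closed nc =
  (λ _ (a , A≉𝟏) → elem⇒inM a , A≉𝟏) ,
  λ _ _ (a , A≉𝟏) (b , _) → elem-⊗ closed a b , A≉𝟏 ∘ ⊗≈𝟏⇒≈𝟏 nc a b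

valid-𝟏 : ∀ {n} → 1 ℕ.≤ n → Valid n 0ℤ 1 n
valid-𝟏 {n} =
  fits⇒valid {n} {0ℤ} (mkFits ℤ.≤-refl ℤ.≤-refl ℤ.≤-refl (ℤ.≤-reflexive (ℤ.+-identityʳ (+ n))))

-- Powers

power-band : ∀ {n d k m} → Fits n d (+ k) (+ m) → ∀ j →
  Band (⟨_,_,_⟩ {n} d k m ^ suc j) (+ j * d + d) (lower (+ k) (+ j * d)) (upper (+ m) (+ j * d))
power-band {d = d} {k} {m} F zero =
  band-cong (sym (ℤ.+-identityˡ d))
            (sym (lower-nonNeg (+ k) ℤ.≤-refl)) (sym (upper-nonPos (+ m) ℤ.≤-refl))
            (band-resp-≈ (sym ∘₂ ⊗-identityʳ ⟨ d , k , m ⟩) (⟨⟩-band d k m))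
power-band {d = d} {k} {m} F (suc j) =
  band-cong diagonal (trans (lower-step (+ k) sign) (cong (lower (+ k)) d+t≡))
                     (trans (upper-step (+ m) sign) (cong (upper (+ m)) d+t≡))
            (band-⊗ 1≤lower upper≤n (⟨⟩-band d k m) (power-band F j))
  where
  t = + j * d
  sign = sameSign-* j d
  d+t≡ : d + t ≡ + suc j * d
  d+t≡ = sym (ℤ.suc-* (+ j) d)
  diagonal : d + (t + d) ≡ + suc j * d + d
  diagonal = trans (sym (ℤ.+-assoc d t d)) (cong (_+ d) d+t≡)
  1≤lower = ℤ.≤-trans (firstRow≥1 F) (ℤ.i≤i⊔j (+ k) (+ k - t))
  upper≤n = ℤ.≤-trans (ℤ.i⊓j≤i (+ m) (+ m - t)) (lastRow≤n F)

power-vanishes : ∀ {n d k m} → Fits n d (+ k) (+ m) → ∀ j →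
  m ℕ.< k ℕ.+ j ℕ.* ∣ d ∣ → ⟨_,_,_⟩ {n} d k m ^ suc j ≈ 𝟎
power-vanishes {d = d} {k} {m} F j m<k+j∣d∣ = band-empty (ℤ.≰⇒> λ lower≤upper →
  ℕ.<⇒≱ m<k+j∣d∣ (subst (λ x → k ℕ.+ x ℕ.≤ m) (ℤ.abs-* (+ j) d)
                          (to (lower≤upper⇔ k m (+ j * d)) lower≤upper)))
  (power-band F j)

power-nonvanishing : ∀ {n d k m} → Fits n d (+ k) (+ m) → ∀ j →
  k ℕ.+ j ℕ.* ∣ d ∣ ℕ.≤ m → ¬ (⟨_,_,_⟩ {n} d k m ^ suc j ≈ 𝟎)
power-nonvanishing {d = d} {k} {m} F j k+j∣d∣≤m =
  band-nonzero (power-band F j)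
               (fits-⊗ {e = + j * d} (firstRow≥1 F) (lastRow≤n F) F)
               (from (lower≤upper⇔ k m (+ j * d))
                     (subst (λ x → k ℕ.+ x ℕ.≤ m) (sym (ℤ.abs-* (+ j) d)) k+j∣d∣≤m))

m≤⌈m/n⌉*n : ∀ m n → m ℕ.≤ ceilDiv m (suc n) ℕ.* suc n
m≤⌈m/n⌉*n m n = ℕ.+-cancelˡ-≤ n m _ (begin
  n ℕ.+ m                                ≡⟨ ℕ.+-comm n m ⟩
  m ℕ.+ n                                ≡⟨ ℕ.m≡m%n+[m/n]*n (m ℕ.+ n) (suc n) ⟩
  (m ℕ.+ n) ℕ.% suc n ℕ.+ q ℕ.* suc n    ≤⟨ ℕ.+-monoˡ-≤ (q ℕ.* suc n) %≤n ⟩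
  n ℕ.+ q ℕ.* suc n                       ∎)
  where
  open ℕ.≤-Reasoning
  q = ceilDiv m (suc n)
  %≤n = ℕ.s≤s⁻¹ (ℕ.m%n<n (m ℕ.+ n) (suc n))

o<⌈m/n⌉⇒o*n<m : ∀ m n o → o ℕ.< ceilDiv m (suc n) → o ℕ.* suc n ℕ.< m
o<⌈m/n⌉⇒o*n<m m n o o<q = ℕ.+-cancelˡ-≤ n _ _ (begin
  n ℕ.+ suc (o ℕ.* suc n)       ≡⟨ ℕ.+-suc n _ ⟩
  suc o ℕ.* suc n               ≤⟨ ℕ.*-monoˡ-≤ (suc n) o<q ⟩
  ceilDiv m (suc n) ℕ.* suc n   ≤⟨ ℕ.m/n*n≤m (m ℕ.+ n) (suc n) ⟩
  m ℕ.+ n                       ≡⟨ ℕ.+-comm m n ⟩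
  n ℕ.+ m                       ∎)
  where open ℕ.≤-Reasoning

nilpotencyIndex : ∀ {n d k m δ} → Fits n d (+ k) (+ m) → k ℕ.≤ m → ∣ d ∣ ≡ suc δ →
  NilpotencyIndex (⟨_,_,_⟩ {n} d k m) (1 ℕ.+ ceilDiv (suc m ℕ.∸ k) (suc δ))
nilpotencyIndex {n} {d} {k} {m} {δ} F k≤m ∣d∣≡1+δ = power-vanishes F c vanishes , nonvanishing
  where
  open ℕ.≤-Reasoning
  c = ceilDiv (suc m ℕ.∸ k) (suc δ)
  vanishes : m ℕ.< k ℕ.+ c ℕ.* ∣ d ∣
  vanishes = begin-strict
    m                         <⟨ ℕ.n<1+n m ⟩
    suc m                     ≤⟨ ℕ.m≤n+m∸n (suc m) k ⟩
    k ℕ.+ (suc m ℕ.∸ k)       ≤⟨ ℕ.+-monoʳ-≤ k (m≤⌈m/n⌉*n (suc m ℕ.∸ k) δ) ⟩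
    k ℕ.+ c ℕ.* suc δ         ≡⟨ cong (λ x → k ℕ.+ c ℕ.* x) ∣d∣≡1+δ ⟨
    k ℕ.+ c ℕ.* ∣ d ∣         ∎
  nonvanishing : ∀ i → i ℕ.< 1 ℕ.+ c → ¬ (⟨_,_,_⟩ {n} d k m ^ i ≈ 𝟎)
  nonvanishing zero    _ =
    𝟏≉𝟎 (ℤ.drop‿+≤+ (ℤ.≤-trans (firstRow≥1 F) (ℤ.≤-trans (+≤+ k≤m) (lastRow≤n F))))
  nonvanishing (suc j) (s≤s j<c) = power-nonvanishing F j (begin
    k ℕ.+ j ℕ.* ∣ d ∣         ≡⟨ cong (λ x → k ℕ.+ j ℕ.* x) ∣d∣≡1+δ ⟩
    k ℕ.+ j ℕ.* suc δ         ≡⟨ ℕ.+-comm k _ ⟩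
    j ℕ.* suc δ ℕ.+ k         ≤⟨ ℕ.s≤s⁻¹ (ℕ.m≤o∸n⇒m+n≤o (suc (j ℕ.* suc δ)) (ℕ.m≤n⇒m≤1+n k≤m)
                                  (o<⌈m/n⌉⇒o*n<m (suc m ℕ.∸ k) δ j j<c)) ⟩
    m                         ∎)

nilpotencyIndex-⟨⟩ : ∀ {n} d k m → Valid n d k m → d ≢ 0ℤ →
  NilpotencyIndex (⟨_,_,_⟩ {n} d k m) (1 ℕ.+ ceilDiv (suc m ℕ.∸ k) ∣ d ∣)
nilpotencyIndex-⟨⟩ (+ zero)    _ _ _ d≢0 = contradiction refl d≢0
nilpotencyIndex-⟨⟩ d@(+ suc _) _ _ v _   = nilpotencyIndex (valid⇒fits d v) (proj₁ (proj₂ v)) refl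
nilpotencyIndex-⟨⟩ d@(-[1+ _ ]) _ _ v _  = nilpotencyIndex (valid⇒fits d v) (proj₁ (proj₂ v)) refl

elem-nilpotent : ∀ {n R} {A : Matrix n} →
  (∀ {d k m} → R d k m → d ≢ 0ℤ) → Elem n R A → IsNilpotent A
elem-nilpotent _ (inj₁ A≈𝟎) = 1 , ⊗-zeroˡ 𝟏 A≈𝟎
elem-nilpotent d≢0 (inj₂ (d , k , m , v , r , A≈)) =
  ι , λ i j → trans (^-cong A≈ ι i j) (proj₁ (nilpotencyIndex-⟨⟩ d k m v (d≢0 r)) i j)
  where ι = 1 ℕ.+ ceilDiv (suc m ℕ.∸ k) ∣ d ∣

Unital : Kind → Set
Unital K = K ≡ UT ⊎ K ≡ UF ⊎ K ≡ LT ⊎ K ≡ LF ⊎ K ≡ D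

Strict : Kind → Set
Strict K = K ≡ SUT ⊎ K ≡ SUF ⊎ K ≡ SLT ⊎ K ≡ SLF

nonNeg-+≡0 : ∀ {i j} → 0ℤ ≤ i → 0ℤ ≤ j → i + j ≡ 0ℤ → i ≡ 0ℤ
nonNeg-+≡0 {i} {j} 0≤i 0≤j i+j≡0 =
  ℤ.≤-antisym (subst (i ≤_) i+j≡0 (ℤ.i≤i+j i j {{ℤ.nonNegative 0≤j}})) 0≤i

nonPos-+≡0 : ∀ {i j} → i ≤ 0ℤ → j ≤ 0ℤ → i + j ≡ 0ℤ → i ≡ 0ℤ
nonPos-+≡0 {i} {j} i≤0 j≤0 i+j≡0 =
  ℤ.≤-antisym i≤0 (subst (_≤ i) i+j≡0 (subst (i + j ≤_) (ℤ.+-identityʳ i) (ℤ.+-monoʳ-≤ i j≤0)))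

restr-𝟏 : ∀ {n} K → Unital K → Restr n K 0ℤ 1 n
restr-𝟏 .UT (inj₁ refl)                      = ℤ.≤-refl
restr-𝟏 .UF (inj₂ (inj₁ refl))               = ℤ.≤-refl , refl , sym (ℤ.+-identityʳ _)
restr-𝟏 .LT (inj₂ (inj₂ (inj₁ refl)))        = ℤ.≤-refl
restr-𝟏 .LF (inj₂ (inj₂ (inj₂ (inj₁ refl)))) = ℤ.≤-refl , refl , refl
restr-𝟏 .D  (inj₂ (inj₂ (inj₂ (inj₂ refl)))) = refl

restr-nonCancelling : ∀ {n} K → Unital K → NonCancelling (Restr n K)
restr-nonCancelling .UT (inj₁ refl)                      r r′ = nonNeg-+≡0 r r′
restr-nonCancelling .UF (inj₂ (inj₁ refl))               r r′ = nonNeg-+≡0 (proj₁ r) (proj₁ r′)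
restr-nonCancelling .LT (inj₂ (inj₂ (inj₁ refl)))        r r′ = nonPos-+≡0 r r′
restr-nonCancelling .LF (inj₂ (inj₂ (inj₂ (inj₁ refl)))) r r′ = nonPos-+≡0 (proj₁ r) (proj₁ r′)
restr-nonCancelling .D  (inj₂ (inj₂ (inj₂ (inj₂ refl)))) r _  = λ _ → r

restr-diagonal≢0 : ∀ {n} K → Strict K → ∀ {d k m} → Restr n K d k m → d ≢ 0ℤ
restr-diagonal≢0 .SUT (inj₁ refl)               0<d = ℤ.<⇒≢ 0<d ∘ sym
restr-diagonal≢0 .SUF (inj₂ (inj₁ refl))        r   = ℤ.<⇒≢ (proj₁ r) ∘ sym
restr-diagonal≢0 .SLT (inj₂ (inj₂ (inj₁ refl))) d<0 = ℤ.<⇒≢ d<0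
restr-diagonal≢0 .SLF (inj₂ (inj₂ (inj₂ refl))) r   = ℤ.<⇒≢ (proj₁ r)

theorem12 : (n : ℕ) → 2 ℕ.≤ n →
    (∀ K → IsSubsemigroupOf (InK n K) (InM n))
    × (∀ K → (K ≡ UT ⊎ K ≡ UF ⊎ K ≡ LT ⊎ K ≡ LF ⊎ K ≡ D) →
         InK n K 𝟏 × IsSubmonoidOfM n (InK n K)
         × IsSubsemigroupOf (InKminus1 n K) (InS n))
    × (∀ K → (K ≡ SUT ⊎ K ≡ SUF ⊎ K ≡ SLT ⊎ K ≡ SLF) →
         (∀ A → InK n K A → IsNilpotent A)
         × (∀ (d : ℤ) (k m : ℕ) → Valid n d k m → Restr n K d k m →
              NilpotencyIndex (⟨_,_,_⟩ {n} d k m) (1 ℕ.+ ceilDiv (suc m ℕ.∸ k) ∣ d ∣)))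
theorem12 n 2≤n =
  (λ K → isSubsemigroup (restr-productClosed K)) ,
  (λ K unital → 𝟏∈ K unital , (isSubsemigroup (restr-productClosed K) , 𝟏∈ K unital) ,
                isSubsemigroup-∖𝟏 (restr-productClosed K) (restr-nonCancelling K unital)) ,
  (λ K strict → (λ _ → elem-nilpotent (restr-diagonal≢0 K strict)) ,
                λ d k m v r → nilpotencyIndex-⟨⟩ d k m v (restr-diagonal≢0 K strict r))
  where
  𝟏∈ : ∀ K → Unital K → InK n K 𝟏
  𝟏∈ K unital = inj₂ (0ℤ , 1 , n , valid-𝟏 (ℕ.<⇒≤ 2≤n) , restr-𝟏 K unital , λ _ _ → refl)
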